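{- Let $\lambda\in\mathbf{C}$ with $\lambda\neq 1$, let $r,n\in\mathbf{Z}_{+}$, and let $p(x)$ be a polynomial with coefficients in $\mathbf{Q}(\lambda)$ of degree at most $n$. Write $p(x)=\sum_{k=0}^{n}C_{k}H_{k}^{(r)}(x\vert\lambda)$ with $C_k\in\mathbf{Q}(\lambda)$. Then $$C_{k}=\frac{1}{(1-\lambda)^{r}k!}\sum_{j=0}^{r}\binom{r}{j}(-\lambda)^{r-j}D^{k}p(j),$$ where $D^kp(j)$ denotes the $k$-th derivative of $p$ evaluated at $x=j$. That is, $$p(x)=\frac{1}{(1-\lambda)^{r}}\sum_{k=0}^{n}\Bigl(\sum_{j=0}^{r}\frac{1}{k!}\binom{r}{j}(-\lambda)^{r-j}D^{k}p(j)\Bigr)H_{k}^{(r)}(x\vert\lambda).$$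
   Context: For $\lambda\in\mathbf{C}$, $\lambda\neq1$, and $r\in\mathbf{Z}_+$, the Frobenius–Euler polynomials of order $r$ are defined by $\left(\frac{1-\lambda}{e^{t}-\lambda}\right)^{r}e^{xt}=\sum_{n=0}^{\infty}H_{n}^{(r)}(x\vert\lambda)\frac{t^{n}}{n!}$. Each $H_n^{(r)}(x\vert\lambda)$ is a monic polynomial of degree $n$ with coefficients in $\mathbf{Q}(\lambda)$, so $H_0^{(r)}(x\vert\lambda),\dots,H_n^{(r)}(x\vert\lambda)$ form a basis of the polynomials of degree at most $n$ over $\mathbf{Q}(\lambda)$. $\mathbf{Z}_+$ denotes the nonnegative integers. -}

module Defs where

open import Level using (_⊔_)
open import Algebra.Bundles using (CommutativeRing)
open import Data.Nat as ℕ using (ℕ; zero; suc)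
open import Data.Nat.Combinatorics using (_C_)
open import Data.List using (List; []; _∷_)
open import Data.Product using (∃)
open import Relation.Nullary using (¬_)

record Field (c ℓ : Level.Level) : Set (Level.suc (c ⊔ ℓ)) where
  field
    commutativeRing : CommutativeRing c ℓ
  open CommutativeRing commutativeRing
  field
    0≉1     : ¬ (0# ≈ 1#)
    inverse : ∀ x → ¬ (x ≈ 0#) → ∃ λ y → x * y ≈ 1#

module FieldDefs {c ℓ} (F : Field c ℓ) where
  open Field F
  open CommutativeRing commutativeRing

  fromℕ : ℕ → Carrier
  fromℕ zero    = 0#
  fromℕ (suc m) = 1# + fromℕ m

  CharZero : Set ℓ
  CharZero = ∀ m → ¬ (fromℕ (suc m) ≈ 0#)

  _^_ : Carrier → ℕ → Carrier
  x ^ zero  = 1#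
  x ^ suc m = x * (x ^ m)

  sumTo : ℕ → (ℕ → Carrier) → Carrier
  sumTo zero    f = f 0
  sumTo (suc n) f = sumTo n f + f (suc n)

  -- Polynomials over F as coefficient lists (constant term first).
  Poly : Set c
  Poly = List Carrier

  coeff : Poly → ℕ → Carrier
  coeff []       _       = 0#
  coeff (a ∷ as) zero    = a
  coeff (a ∷ as) (suc i) = coeff as i

  eval : Poly → Carrier → Carrier
  eval []       x = 0#
  eval (a ∷ as) x = a + x * eval as x

  private
    derivFrom : ℕ → Poly → Poly
    derivFrom m []       = []
    derivFrom m (b ∷ bs) = (fromℕ m * b) ∷ derivFrom (suc m) bs

  deriv : Poly → Poly
  deriv []       = []
  deriv (a ∷ as) = derivFrom 1 as

  derivN : ℕ → Poly → Poly
  derivN zero    p = p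
  derivN (suc k) p = deriv (derivN k p)

  -- Exponential generating functions: a sequence a stands for Σ a n t^n/n!.
  EGF : Set c
  EGF = ℕ → Carrier

  egf-one : EGF
  egf-one zero    = 1#
  egf-one (suc _) = 0#

  egf-mul : EGF → EGF → EGF
  egf-mul a b n = sumTo n (λ k → fromℕ (n C k) * (a k * b (n ℕ.∸ k)))

  egf-pow : EGF → ℕ → EGF
  egf-pow a zero    = egf-one
  egf-pow a (suc r) = egf-mul a (egf-pow a r)

  -- e^t - λ
  expMinus : Carrier → EGF
  expMinus λ′ zero    = 1# + - λ′
  expMinus λ′ (suc _) = 1#

  -- H : ℕ → Poly are the Frobenius–Euler polynomials of order r, i.e.
  --   ((1-λ)/(e^t-λ))^r e^{xt} = Σ_n H n (x) t^n/n!.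
  -- Since e^t - λ has invertible constant term 1-λ, this is equivalent to
  --   (e^t-λ)^r · Σ_n H n t^n/n! = (1-λ)^r e^{xt},
  -- compared coefficientwise in t and in x (coefficient of t^n/n! on the
  -- right is (1-λ)^r x^n).
  IsFrobeniusEuler : Carrier → ℕ → (ℕ → Poly) → Set ℓ
  IsFrobeniusEuler λ′ r H =
    ∀ n i → sumTo n (λ k → fromℕ (n C k) *
                         (egf-pow (expMinus λ′) r (n ℕ.∸ k) * coeff (H k) i))
            ≈ ((1# + - λ′) ^ r) * δ n i
    where
      δ : ℕ → ℕ → Carrier
      δ zero    zero    = 1#
      δ zero    (suc _) = 0#
      δ (suc _) zero    = 0#
      δ (suc a) (suc b) = δ a b

{-# OPTIONS --safe #-}

-- The defining relation, read coefficientwise in t, says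
--   Σ_k C(n,k) E_{n-k} H_k(x) = (1-λ)^r x^n,   E_m = [t^m/m!] (e^t - λ)^r.
-- Since E_0 = (1-λ)^r is invertible, the H_k are unitriangular, and substituting the
-- monomials of p gives (1-λ)^r C_k = Σ_i p_i C(i,k) E_{i-k}.  As k! C(i,k) x^{i-k} = D^k x^i,
-- multiplying by k! yields Σ_m (D^k p)_m E_m, and the binomial expansion
-- E_m = Σ_j C(r,j) (-λ)^{r-j} j^m turns this into Σ_j C(r,j) (-λ)^{r-j} (D^k p)(j).
module Submission where

open import Defs
open import Algebra.Bundles using (CommutativeRing)
open import Data.Bool.Base using (true)
open import Data.Nat as ℕ using (ℕ; zero; suc; _∸_; _!; _≤_; _<_; z≤n; s≤s)
import Data.Nat.Properties as ℕP
open import Data.Nat.Combinatorics using (_C_; _P_; nCk≡nPk/k!; nCn≡1; k>n⇒nCk≡0; nCk+nC[k+1]≡[n+1]C[k+1])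
open import Data.Nat.Combinatorics.Base using (_P′_)
open import Data.Nat.Combinatorics.Specification using (k!∣nP′k)
open import Data.Nat.DivMod using (_/_; m*[n/m]≡n)
open import Data.List using ([]; _∷_; length)
open import Data.Product using (_×_; _,_; proj₁)
open import Data.Sum using (inj₁; inj₂)
open import Function using (_∘_)
open import Relation.Nullary using (¬_)
open import Data.Empty using (⊥-elim)
open import Data.Nat.Induction using (<-rec)
open import Relation.Binary.PropositionalEquality as ≡ using (_≡_; _≢_)
import Algebra.Properties.CommutativeSemigroup as CommSemigroupProperties
import Algebra.Properties.Group as GroupProperties

nPk≡nP′k : ∀ {n k} → k ≤ n → n P k ≡ n P′ k
nPk≡nP′k {n} {k} k≤n with k ℕ.≤ᵇ n | ℕP.≤⇒≤ᵇ k≤n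
... | true | _ = ≡.refl

k!*nCk≡nP′k : ∀ {n k} → k ≤ n → k ! ℕ.* (n C k) ≡ n P′ k
k!*nCk≡nP′k {n} {k} k≤n = begin
  k ! ℕ.* (n C k)          ≡⟨ ≡.cong (k ! ℕ.*_) (nCk≡nPk/k! k≤n) ⟩
  k ! ℕ.* ((n P k) / k !)  ≡⟨ ≡.cong (λ x → k ! ℕ.* (x / k !)) (nPk≡nP′k k≤n) ⟩
  k ! ℕ.* ((n P′ k) / k !) ≡⟨ m*[n/m]≡n (k!∣nP′k k≤n) ⟩
  n P′ k                   ∎
  where
    open ≡.≡-Reasoning
    instance
      k!≢0 : ℕ.NonZero (k !)
      k!≢0 = k ℕP.!≢0

module OverField {c ℓ} (F : Field c ℓ) where
  open Field F
  open CommutativeRing commutativeRing hiding (zero)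
  open FieldDefs F
  open import Relation.Binary.Reasoning.Setoid setoid
  open CommSemigroupProperties *-commutativeSemigroup using (x∙yz≈y∙xz; x∙yz≈xy∙z; x∙yz≈yx∙z)
  open CommSemigroupProperties +-commutativeSemigroup using (interchange; xy∙z≈xz∙y)
    renaming (x∙yz≈y∙xz to x+[y+z]≈y+[x+z])
  open GroupProperties +-group using (x∙y⁻¹≈ε⇒x≈y; ∙-cancelʳ)

  sumTo-cong : ∀ n {f g : ℕ → Carrier} → (∀ i → i ≤ n → f i ≈ g i) → sumTo n f ≈ sumTo n g
  sumTo-cong zero    f≈g = f≈g 0 z≤n
  sumTo-cong (suc n) f≈g =
    +-cong (sumTo-cong n (λ i i≤n → f≈g i (ℕP.m≤n⇒m≤1+n i≤n))) (f≈g (suc n) ℕP.≤-refl)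

  sumTo-zero : ∀ n {f : ℕ → Carrier} → (∀ i → i ≤ n → f i ≈ 0#) → sumTo n f ≈ 0#
  sumTo-zero n f≈0 = trans (sumTo-cong n f≈0) (sumTo-const-0 n)
    where
      sumTo-const-0 : ∀ n → sumTo n (λ _ → 0#) ≈ 0#
      sumTo-const-0 zero    = refl
      sumTo-const-0 (suc n) = trans (+-identityʳ _) (sumTo-const-0 n)

  sumTo-+ : ∀ n (f g : ℕ → Carrier) → sumTo n (λ i → f i + g i) ≈ sumTo n f + sumTo n g
  sumTo-+ zero    f g = refl
  sumTo-+ (suc n) f g = trans (+-cong (sumTo-+ n f g) refl) (interchange _ _ _ _)

  *-distribˡ-sumTo : ∀ n a (f : ℕ → Carrier) → a * sumTo n f ≈ sumTo n (λ i → a * f i)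
  *-distribˡ-sumTo zero    a f = refl
  *-distribˡ-sumTo (suc n) a f = trans (distribˡ a _ _) (+-cong (*-distribˡ-sumTo n a f) refl)

  *-distribʳ-sumTo : ∀ n a (f : ℕ → Carrier) → sumTo n f * a ≈ sumTo n (λ i → f i * a)
  *-distribʳ-sumTo zero    a f = refl
  *-distribʳ-sumTo (suc n) a f = trans (distribʳ a _ _) (+-cong (*-distribʳ-sumTo n a f) refl)

  sumTo-suc : ∀ n (f : ℕ → Carrier) → sumTo (suc n) f ≈ f 0 + sumTo n (f ∘ suc)
  sumTo-suc zero    f = refl
  sumTo-suc (suc n) f = trans (+-cong (sumTo-suc n f) refl) (+-assoc _ _ _)

  sumTo-comm : ∀ m n (f : ℕ → ℕ → Carrier) →
    sumTo m (λ i → sumTo n (f i)) ≈ sumTo n (λ j → sumTo m (λ i → f i j))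
  sumTo-comm zero    n f = refl
  sumTo-comm (suc m) n f =
    trans (+-cong (sumTo-comm m n f) refl) (sym (sumTo-+ n (λ j → sumTo m (λ i → f i j)) (f (suc m))))

  sumTo-single : ∀ n {i} (f : ℕ → Carrier) → i ≤ n →
    (∀ j → j ≤ n → j ≢ i → f j ≈ 0#) → sumTo n f ≈ f i
  sumTo-single zero    f z≤n f≈0 = refl
  sumTo-single (suc n) {i} f i≤1+n f≈0 with ℕP.m≤n⇒m<n∨m≡n i≤1+n
  ... | inj₂ ≡.refl =
    trans (+-cong (sumTo-zero n (λ j j≤n → f≈0 j (ℕP.m≤n⇒m≤1+n j≤n) (ℕP.<⇒≢ (s≤s j≤n)))) refl) (+-identityˡ _)
  ... | inj₁ (s≤s i≤n) = trans (+-cong (sumTo-single n f i≤n (λ j j≤n → f≈0 j (ℕP.m≤n⇒m≤1+n j≤n)))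
                                       (f≈0 (suc n) ℕP.≤-refl (ℕP.>⇒≢ (s≤s i≤n))))
                               (+-identityʳ _)

  sumTo-truncate : ∀ {m n} (f : ℕ → Carrier) → m ≤ n → (∀ i → m < i → f i ≈ 0#) → sumTo n f ≈ sumTo m f
  sumTo-truncate {n = zero}  f z≤n     f≈0 = refl
  sumTo-truncate {n = suc n} f m≤1+n f≈0 with ℕP.m≤n⇒m<n∨m≡n m≤1+n
  ... | inj₂ ≡.refl     = refl
  ... | inj₁ (s≤s m≤n) = trans (+-cong (sumTo-truncate f m≤n f≈0) (f≈0 (suc n) (s≤s m≤n))) (+-identityʳ _)

  sumTo-offset : ∀ m k (f : ℕ → Carrier) → (∀ i → i < k → f i ≈ 0#) →
    sumTo (m ℕ.+ k) f ≈ sumTo m (λ i → f (i ℕ.+ k))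
  sumTo-offset m zero f f≈0 rewrite ℕP.+-identityʳ m =
    sumTo-cong m (λ i _ → reflexive (≡.cong f (≡.sym (ℕP.+-identityʳ i))))
  sumTo-offset m (suc k) f f≈0 rewrite ℕP.+-suc m k = begin
    sumTo (suc (m ℕ.+ k)) f                ≈⟨ sumTo-suc (m ℕ.+ k) f ⟩
    f 0 + sumTo (m ℕ.+ k) (f ∘ suc)
      ≈⟨ +-cong (f≈0 0 (s≤s z≤n)) (sumTo-offset m k (f ∘ suc) (λ i i<k → f≈0 (suc i) (s≤s i<k))) ⟩
    0# + sumTo m (λ i → f (suc (i ℕ.+ k))) ≈⟨ +-identityˡ _ ⟩
    sumTo m (λ i → f (suc (i ℕ.+ k)))      ≈⟨ sumTo-cong m (λ i _ → reflexive (≡.cong f (≡.sym (ℕP.+-suc i k)))) ⟩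
    sumTo m (λ i → f (i ℕ.+ suc k))        ∎

  fromℕ-cong : ∀ {a b} → a ≡ b → fromℕ a ≈ fromℕ b
  fromℕ-cong e = reflexive (≡.cong fromℕ e)

  fromℕ-1* : ∀ x → fromℕ 1 * x ≈ x
  fromℕ-1* x = trans (*-cong (+-identityʳ 1#) refl) (*-identityˡ x)

  fromℕ-+ : ∀ a b → fromℕ (a ℕ.+ b) ≈ fromℕ a + fromℕ b
  fromℕ-+ zero    b = sym (+-identityˡ _)
  fromℕ-+ (suc a) b = trans (+-cong refl (fromℕ-+ a b)) (sym (+-assoc _ _ _))

  fromℕ-* : ∀ a b → fromℕ (a ℕ.* b) ≈ fromℕ a * fromℕ b
  fromℕ-* zero    b = sym (zeroˡ _)
  fromℕ-* (suc a) b = begin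
    fromℕ (b ℕ.+ a ℕ.* b)        ≈⟨ fromℕ-+ b (a ℕ.* b) ⟩
    fromℕ b + fromℕ (a ℕ.* b)    ≈⟨ +-cong (sym (*-identityˡ _)) (fromℕ-* a b) ⟩
    1# * fromℕ b + fromℕ a * fromℕ b ≈⟨ sym (distribʳ _ _ _) ⟩
    (1# + fromℕ a) * fromℕ b     ∎

  x≈0⇒x*y≈0 : ∀ {x y} → x ≈ 0# → x * y ≈ 0#
  x≈0⇒x*y≈0 x≈0 = trans (*-cong x≈0 refl) (zeroˡ _)

  y≈0⇒x*y≈0 : ∀ {x y} → y ≈ 0# → x * y ≈ 0#
  y≈0⇒x*y≈0 y≈0 = trans (*-cong refl y≈0) (zeroʳ _)

  k>n⇒nCk*x≈0 : ∀ {n k} x → n < k → fromℕ (n C k) * x ≈ 0#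
  k>n⇒nCk*x≈0 x n<k = x≈0⇒x*y≈0 (fromℕ-cong (k>n⇒nCk≡0 n<k))

  binomialSum : ℕ → Carrier → (ℕ → Carrier) → Carrier
  binomialSum r w f = sumTo r (λ j → fromℕ (r C j) * (w ^ (r ∸ j) * f j))

  binomialSum-cong : ∀ r w {f g : ℕ → Carrier} → (∀ j → j ≤ r → f j ≈ g j) →
    binomialSum r w f ≈ binomialSum r w g
  binomialSum-cong r w f≈g = sumTo-cong r (λ j j≤r → *-cong refl (*-cong refl (f≈g j j≤r)))

  binomialSum-suc : ∀ r w f → binomialSum (suc r) w f ≈ binomialSum r w (f ∘ suc) + w * binomialSum r w f
  binomialSum-suc r w f = begin
    binomialSum (suc r) w f                              ≈⟨ sumTo-suc r term ⟩
    term 0 + sumTo r (term ∘ suc)                         ≈⟨ +-cong refl (sumTo-cong r (λ j _ → pascal j)) ⟩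
    term 0 + sumTo r (λ j → shifted j + kept j)           ≈⟨ +-cong refl (sumTo-+ r shifted kept) ⟩
    term 0 + (binomialSum r w (f ∘ suc) + sumTo r kept)   ≈⟨ x+[y+z]≈y+[x+z] _ _ _ ⟩
    binomialSum r w (f ∘ suc) + (term 0 + sumTo r kept)   ≈⟨ +-cong refl lowered ⟩
    binomialSum r w (f ∘ suc) + w * binomialSum r w f     ∎
    where
      term shifted kept : ℕ → Carrier
      term j    = fromℕ (suc r C j) * (w ^ (suc r ∸ j) * f j)
      shifted j = fromℕ (r C j) * (w ^ (r ∸ j) * f (suc j))
      kept j    = fromℕ (r C suc j) * (w ^ (r ∸ j) * f (suc j))
      pascal : ∀ j → term (suc j) ≈ shifted j + kept j
      pascal j = trans (*-cong (trans (fromℕ-cong (≡.sym (nCk+nC[k+1]≡[n+1]C[k+1] r j))) (fromℕ-+ (r C j) (r C suc j))) refl)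
                       (distribʳ _ _ _)
      low : ℕ → Carrier
      low j = fromℕ (r C j) * (w ^ (suc r ∸ j) * f j)
      raised : ∀ j → j ≤ r → low j ≈ w * (fromℕ (r C j) * (w ^ (r ∸ j) * f j))
      raised j j≤r = begin
        fromℕ (r C j) * (w ^ (suc r ∸ j) * f j)
          ≡⟨ ≡.cong (λ e → fromℕ (r C j) * (w ^ e * f j)) (ℕP.+-∸-assoc 1 j≤r) ⟩
        fromℕ (r C j) * ((w * w ^ (r ∸ j)) * f j)      ≈⟨ *-cong refl (*-assoc _ _ _) ⟩
        fromℕ (r C j) * (w * (w ^ (r ∸ j) * f j))      ≈⟨ x∙yz≈y∙xz _ _ _ ⟩
        w * (fromℕ (r C j) * (w ^ (r ∸ j) * f j))      ∎
      lowered : term 0 + sumTo r kept ≈ w * binomialSum r w f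
      lowered = begin
        term 0 + sumTo r kept       ≈⟨ sym (sumTo-suc r low) ⟩
        sumTo r low + low (suc r)   ≈⟨ +-cong refl (k>n⇒nCk*x≈0 _ (ℕP.n<1+n r)) ⟩
        sumTo r low + 0#            ≈⟨ +-identityʳ _ ⟩
        sumTo r low                 ≈⟨ sumTo-cong r raised ⟩
        sumTo r (λ j → w * (fromℕ (r C j) * (w ^ (r ∸ j) * f j))) ≈⟨ sym (*-distribˡ-sumTo r w _) ⟩
        w * binomialSum r w f       ∎

  binomial-theorem : ∀ m x → binomialSum m x (λ _ → 1#) ≈ (1# + x) ^ m
  binomial-theorem zero    x = trans (fromℕ-1* _) (*-identityˡ 1#)
  binomial-theorem (suc m) x = begin
    binomialSum (suc m) x (λ _ → 1#)                            ≈⟨ binomialSum-suc m x _ ⟩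
    binomialSum m x (λ _ → 1#) + x * binomialSum m x (λ _ → 1#)
      ≈⟨ +-cong (binomial-theorem m x) (*-cong refl (binomial-theorem m x)) ⟩
    (1# + x) ^ m + x * (1# + x) ^ m                             ≈⟨ +-cong (sym (*-identityˡ _)) refl ⟩
    1# * (1# + x) ^ m + x * (1# + x) ^ m                        ≈⟨ sym (distribʳ _ _ _) ⟩
    (1# + x) * (1# + x) ^ m                                     ∎

  binomialSum-sumTo : ∀ r w n (d : ℕ → Carrier) (g : ℕ → ℕ → Carrier) →
    binomialSum r w (λ j → sumTo n (λ m → d m * g j m)) ≈ sumTo n (λ m → d m * binomialSum r w (λ j → g j m))
  binomialSum-sumTo r w n d g = begin
    binomialSum r w (λ j → sumTo n (λ m → d m * g j m))
      ≈⟨ sumTo-cong r (λ j _ → trans (*-cong refl (*-distribˡ-sumTo n _ _)) (*-distribˡ-sumTo n _ _)) ⟩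
    sumTo r (λ j → sumTo n (λ m → fromℕ (r C j) * (w ^ (r ∸ j) * (d m * g j m))))
      ≈⟨ sumTo-comm r n _ ⟩
    sumTo n (λ m → sumTo r (λ j → fromℕ (r C j) * (w ^ (r ∸ j) * (d m * g j m))))
      ≈⟨ sumTo-cong n (λ m _ → trans (sumTo-cong r (λ j _ → pull (d m))) (sym (*-distribˡ-sumTo r (d m) _))) ⟩
    sumTo n (λ m → d m * binomialSum r w (λ j → g j m)) ∎
    where
      pull : ∀ {a b y} x → a * (b * (x * y)) ≈ x * (a * (b * y))
      pull x = trans (*-cong refl (x∙yz≈y∙xz _ _ _)) (x∙yz≈y∙xz _ _ _)

  expMinus-constant : ∀ λ′ x → fromℕ 1 * (expMinus λ′ 0 * x) ≈ fromℕ 1 * x + - λ′ * x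
  expMinus-constant λ′ x = begin
    fromℕ 1 * ((1# + - λ′) * x)  ≈⟨ fromℕ-1* _ ⟩
    (1# + - λ′) * x              ≈⟨ distribʳ _ _ _ ⟩
    1# * x + - λ′ * x            ≈⟨ +-cong (trans (*-identityˡ x) (sym (fromℕ-1* x))) refl ⟩
    fromℕ 1 * x + - λ′ * x       ∎

  expMinus-mul : ∀ λ′ (b : EGF) m →
    egf-mul (expMinus λ′) b m ≈ sumTo m (λ k → fromℕ (m C k) * b (m ∸ k)) + - λ′ * b m
  expMinus-mul λ′ b zero    = expMinus-constant λ′ (b 0)
  expMinus-mul λ′ b (suc m) = begin
    egf-mul (expMinus λ′) b (suc m)
      ≈⟨ sumTo-suc m _ ⟩
    fromℕ 1 * (expMinus λ′ 0 * b (suc m)) + sumTo m (λ k → fromℕ (suc m C suc k) * (1# * b (m ∸ k)))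
      ≈⟨ +-cong (expMinus-constant λ′ (b (suc m))) (sumTo-cong m (λ k _ → *-cong refl (*-identityˡ _))) ⟩
    (fromℕ 1 * b (suc m) + - λ′ * b (suc m)) + sumTo m (λ k → fromℕ (suc m C suc k) * b (m ∸ k))
      ≈⟨ xy∙z≈xz∙y _ _ _ ⟩
    (fromℕ 1 * b (suc m) + sumTo m (λ k → fromℕ (suc m C suc k) * b (m ∸ k))) + - λ′ * b (suc m)
      ≈⟨ +-cong (sym (sumTo-suc m _)) refl ⟩
    sumTo (suc m) (λ k → fromℕ (suc m C k) * b (suc m ∸ k)) + - λ′ * b (suc m) ∎

  expMinus-pow : ∀ λ′ r m → egf-pow (expMinus λ′) r m ≈ binomialSum r (- λ′) (λ j → fromℕ j ^ m)
  expMinus-pow λ′ zero    zero    = sym (binomial-theorem 0 (- λ′))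
  expMinus-pow λ′ zero    (suc m) = sym (y≈0⇒x*y≈0 (trans (*-identityˡ _) (zeroˡ _)))
  expMinus-pow λ′ (suc r) m = begin
    egf-mul (expMinus λ′) (egf-pow (expMinus λ′) r) m
      ≈⟨ expMinus-mul λ′ (egf-pow (expMinus λ′) r) m ⟩
    sumTo m (λ k → fromℕ (m C k) * egf-pow (expMinus λ′) r (m ∸ k)) + w * egf-pow (expMinus λ′) r m
      ≈⟨ +-cong (sumTo-cong m (λ k _ → *-cong refl (expMinus-pow λ′ r (m ∸ k)))) (*-cong refl (expMinus-pow λ′ r m)) ⟩
    sumTo m (λ k → fromℕ (m C k) * binomialSum r w (λ j → fromℕ j ^ (m ∸ k))) + w * binomialSum r w (λ j → fromℕ j ^ m)
      ≈⟨ +-cong (sym (binomialSum-sumTo r w m (λ k → fromℕ (m C k)) (λ j k → fromℕ j ^ (m ∸ k)))) refl ⟩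
    binomialSum r w (λ j → sumTo m (λ k → fromℕ (m C k) * fromℕ j ^ (m ∸ k))) + w * binomialSum r w (λ j → fromℕ j ^ m)
      ≈⟨ +-cong (binomialSum-cong r w (λ j _ → binomial-theorem′ (fromℕ j))) refl ⟩
    binomialSum r w (λ j → fromℕ (suc j) ^ m) + w * binomialSum r w (λ j → fromℕ j ^ m)
      ≈⟨ sym (binomialSum-suc r w (λ j → fromℕ j ^ m)) ⟩
    binomialSum (suc r) w (λ j → fromℕ j ^ m) ∎
    where
      w : Carrier
      w = - λ′
      binomial-theorem′ : ∀ x → sumTo m (λ k → fromℕ (m C k) * x ^ (m ∸ k)) ≈ (1# + x) ^ m
      binomial-theorem′ x = trans (sumTo-cong m (λ k _ → *-cong refl (sym (*-identityʳ _)))) (binomial-theorem m x)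

  expMinus-pow-zero : ∀ λ′ r → egf-pow (expMinus λ′) r 0 ≈ (1# + - λ′) ^ r
  expMinus-pow-zero λ′ r = trans (expMinus-pow λ′ r 0) (binomial-theorem r (- λ′))

  -- Defs keeps private the helper that `deriv` unfolds to.  Abstracting the literal 1 lets
  -- unification solve `_` with it, and the reflexive component lets `derivTail` read it off.
  DerivTail : (ℕ → Poly → Poly) → Set c
  DerivTail g = (∀ s bs → g s bs ≡ g s bs) × (∀ a as → deriv (a ∷ as) ≡ g 1 as)

  derivTail-spec : DerivTail _
  derivTail-spec with 1
  ... | _ = (λ _ _ → ≡.refl) , (λ _ _ → ≡.refl)

  derivTail : ℕ → Poly → Poly
  derivTail = proj₁ {B = DerivTail} (_ , derivTail-spec)

  coeff-derivTail : ∀ s bs m → coeff (derivTail s bs) m ≈ fromℕ (m ℕ.+ s) * coeff bs m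
  coeff-derivTail s []       m       = sym (zeroʳ _)
  coeff-derivTail s (b ∷ bs) zero    = refl
  coeff-derivTail s (b ∷ bs) (suc m) =
    trans (coeff-derivTail (suc s) bs m) (*-cong (fromℕ-cong (ℕP.+-suc m s)) refl)

  coeff-deriv : ∀ q m → coeff (deriv q) m ≈ fromℕ (suc m) * coeff q (suc m)
  coeff-deriv []       m = sym (zeroʳ _)
  coeff-deriv (a ∷ as) m = trans (coeff-derivTail 1 as m) (*-cong (fromℕ-cong (ℕP.+-comm m 1)) refl)

  coeff-derivN : ∀ k q m → coeff (derivN k q) m ≈ fromℕ ((m ℕ.+ k) P′ k) * coeff q (m ℕ.+ k)
  coeff-derivN zero    q m rewrite ℕP.+-identityʳ m = sym (fromℕ-1* _)
  coeff-derivN (suc k) q m rewrite ℕP.+-suc m k = begin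
    coeff (deriv (derivN k q)) m
      ≈⟨ coeff-deriv (derivN k q) m ⟩
    fromℕ (suc m) * coeff (derivN k q) (suc m)
      ≈⟨ *-cong refl (coeff-derivN k q (suc m)) ⟩
    fromℕ (suc m) * (fromℕ (suc (m ℕ.+ k) P′ k) * coeff q (suc (m ℕ.+ k)))
      ≈⟨ x∙yz≈xy∙z _ _ _ ⟩
    (fromℕ (suc m) * fromℕ (suc (m ℕ.+ k) P′ k)) * coeff q (suc (m ℕ.+ k))
      ≈⟨ *-cong (sym (fromℕ-* (suc m) (suc (m ℕ.+ k) P′ k))) refl ⟩
    fromℕ (suc m ℕ.* (suc (m ℕ.+ k) P′ k)) * coeff q (suc (m ℕ.+ k))
      ≡⟨ ≡.cong (λ e → fromℕ (e ℕ.* (suc (m ℕ.+ k) P′ k)) * coeff q (suc (m ℕ.+ k)))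
                (≡.sym (ℕP.m+n∸n≡m (suc m) k)) ⟩
    fromℕ (suc (m ℕ.+ k) P′ suc k) * coeff q (suc (m ℕ.+ k)) ∎

  coeff-≥length : ∀ q {i} → length q ≤ i → coeff q i ≡ 0#
  coeff-≥length []      _           = ≡.refl
  coeff-≥length (a ∷ q) (s≤s len≤i) = coeff-≥length q len≤i

  eval-sumTo : ∀ q x N → (∀ m → N < m → coeff q m ≈ 0#) → eval q x ≈ sumTo N (λ m → coeff q m * x ^ m)
  eval-sumTo []      x N       _   = sym (sumTo-zero N (λ _ _ → zeroˡ _))
  eval-sumTo (a ∷ q) x zero    q≈0 = begin
    a + x * eval q x             ≈⟨ +-cong refl (*-cong refl (eval-sumTo q x 0 (λ m 0<m → q≈0 (suc m) (s≤s z≤n)))) ⟩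
    a + x * (coeff q 0 * 1#)     ≈⟨ +-cong refl (*-cong refl (*-cong (q≈0 1 (s≤s z≤n)) refl)) ⟩
    a + x * (0# * 1#)            ≈⟨ +-cong refl (trans (*-cong refl (zeroˡ 1#)) (zeroʳ x)) ⟩
    a + 0#                       ≈⟨ +-identityʳ a ⟩
    a                            ≈⟨ sym (*-identityʳ a) ⟩
    a * 1#                       ∎
  eval-sumTo (a ∷ q) x (suc N) q≈0 = begin
    a + x * eval q x
      ≈⟨ +-cong (sym (*-identityʳ a)) (*-cong refl (eval-sumTo q x N (λ m N<m → q≈0 (suc m) (s≤s N<m)))) ⟩
    a * 1# + x * sumTo N (λ m → coeff q m * x ^ m)
      ≈⟨ +-cong refl (trans (*-distribˡ-sumTo N x _) (sumTo-cong N (λ m _ → x∙yz≈y∙xz _ _ _))) ⟩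
    a * 1# + sumTo N (λ m → coeff q m * (x * x ^ m))
      ≈⟨ sym (sumTo-suc N (λ m → coeff (a ∷ q) m * x ^ m)) ⟩
    sumTo (suc N) (λ m → coeff (a ∷ q) m * x ^ m) ∎

  coeff-derivN-vanishes : ∀ k q N → (∀ i → N < i → coeff q i ≈ 0#) →
    ∀ m → N < m ℕ.+ k → coeff (derivN k q) m ≈ 0#
  coeff-derivN-vanishes k q N q≈0 m N<m+k =
    trans (coeff-derivN k q m) (y≈0⇒x*y≈0 (q≈0 (m ℕ.+ k) N<m+k))

  expMinus-pow-eval : ∀ λ′ r q N → (∀ m → N < m → coeff q m ≈ 0#) →
    sumTo N (λ m → coeff q m * egf-pow (expMinus λ′) r m) ≈ binomialSum r (- λ′) (λ j → eval q (fromℕ j))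
  expMinus-pow-eval λ′ r q N q≈0 = begin
    sumTo N (λ m → coeff q m * egf-pow (expMinus λ′) r m)
      ≈⟨ sumTo-cong N (λ m _ → *-cong refl (expMinus-pow λ′ r m)) ⟩
    sumTo N (λ m → coeff q m * binomialSum r (- λ′) (λ j → fromℕ j ^ m))
      ≈⟨ sym (binomialSum-sumTo r (- λ′) N (coeff q) (λ j m → fromℕ j ^ m)) ⟩
    binomialSum r (- λ′) (λ j → sumTo N (λ m → coeff q m * fromℕ j ^ m))
      ≈⟨ binomialSum-cong r (- λ′) (λ j _ → sym (eval-sumTo q (fromℕ j) N q≈0)) ⟩
    binomialSum r (- λ′) (λ j → eval q (fromℕ j)) ∎

  *-cancelˡ-≉0 : ∀ {z u v} → ¬ (z ≈ 0#) → z * u ≈ z * v → u ≈ v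
  *-cancelˡ-≉0 {z} {u} {v} z≉0 zu≈zv with inverse z z≉0
  ... | z⁻¹ , zz⁻¹≈1 = begin
    u                 ≈⟨ sym (undo u) ⟩
    z⁻¹ * (z * u)     ≈⟨ *-cong refl zu≈zv ⟩
    z⁻¹ * (z * v)     ≈⟨ undo v ⟩
    v                 ∎
    where
      undo : ∀ x → z⁻¹ * (z * x) ≈ x
      undo x = begin
        z⁻¹ * (z * x)   ≈⟨ sym (*-assoc _ _ _) ⟩
        (z⁻¹ * z) * x   ≈⟨ *-cong (trans (*-comm _ _) zz⁻¹≈1) refl ⟩
        1# * x          ≈⟨ *-identityˡ x ⟩
        x               ∎

  *-≉0 : ∀ {x y} → ¬ (x ≈ 0#) → ¬ (y ≈ 0#) → ¬ (x * y ≈ 0#)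
  *-≉0 x≉0 y≉0 xy≈0 = y≉0 (*-cancelˡ-≉0 x≉0 (trans xy≈0 (sym (zeroʳ _))))

  ^-≉0 : ∀ {x} → ¬ (x ≈ 0#) → ∀ r → ¬ (x ^ r ≈ 0#)
  ^-≉0 x≉0 zero    = 0≉1 ∘ sym
  ^-≉0 x≉0 (suc r) = *-≉0 x≉0 (^-≉0 x≉0 r)

  1-x≉0 : ∀ {x} → ¬ (x ≈ 1#) → ¬ (1# + - x ≈ 0#)
  1-x≉0 x≉1 1-x≈0 = x≉1 (sym (x∙y⁻¹≈ε⇒x≈y _ _ 1-x≈0))

  δ : ℕ → ℕ → Carrier
  δ zero    zero    = 1#
  δ zero    (suc _) = 0#
  δ (suc _) zero    = 0#
  δ (suc m) (suc n) = δ m n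

  δ-diag : ∀ n → δ n n ≈ 1#
  δ-diag zero    = refl
  δ-diag (suc n) = δ-diag n

  δ-≢ : ∀ {m n} → m ≢ n → δ m n ≈ 0#
  δ-≢ {zero}  {zero}  0≢0 = ⊥-elim (0≢0 ≡.refl)
  δ-≢ {zero}  {suc _} _   = refl
  δ-≢ {suc _} {zero}  _   = refl
  δ-≢ {suc m} {suc n} m≢n = δ-≢ (m≢n ∘ ≡.cong suc)

  δ-unique : {d : ℕ → ℕ → Carrier} → d 0 0 ≡ 1# → (∀ n → d 0 (suc n) ≡ 0#) → (∀ m → d (suc m) 0 ≡ 0#) →
    (∀ m n → d (suc m) (suc n) ≡ d m n) → ∀ m n → d m n ≡ δ m n
  δ-unique d00 d0s ds0 dss zero    zero    = d00
  δ-unique d00 d0s ds0 dss zero    (suc n) = d0s n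
  δ-unique d00 d0s ds0 dss (suc m) zero    = ds0 m
  δ-unique d00 d0s ds0 dss (suc m) (suc n) = ≡.trans (dss m n) (δ-unique d00 d0s ds0 dss m n)

  Unitriangular : (ℕ → ℕ → Carrier) → Set ℓ
  Unitriangular h = ∀ k i → k ≤ i → h k i ≈ δ k i

  unitriangular-top-unique : ∀ {h} → Unitriangular h → ∀ N {D D′ : ℕ → Carrier} →
    sumTo N (λ k → D k * h k N) ≈ sumTo N (λ k → D′ k * h k N) → D N ≈ D′ N
  unitriangular-top-unique {h} tri N {D} {D′} same = trans (sym (top D)) (trans same (top D′))
    where
      top : ∀ D → sumTo N (λ k → D k * h k N) ≈ D N
      top D = begin
        sumTo N (λ k → D k * h k N)
          ≈⟨ sumTo-single N _ ℕP.≤-refl (λ k k≤N k≢N → y≈0⇒x*y≈0 (trans (tri k N k≤N) (δ-≢ k≢N))) ⟩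
        D N * h N N                   ≈⟨ *-cong refl (trans (tri N N ℕP.≤-refl) (δ-diag N)) ⟩
        D N * 1#                      ≈⟨ *-identityʳ _ ⟩
        D N                           ∎

  unitriangular-coordinates-unique : ∀ {h} → Unitriangular h → ∀ N {D D′ : ℕ → Carrier} →
    (∀ i → i ≤ N → sumTo N (λ k → D k * h k i) ≈ sumTo N (λ k → D′ k * h k i)) →
    ∀ k → k ≤ N → D k ≈ D′ k
  unitriangular-coordinates-unique {h} tri N {D} {D′} same k k≤N with ℕP.m≤n⇒m<n∨m≡n k≤N
  ... | inj₂ ≡.refl = unitriangular-top-unique tri N (same N ℕP.≤-refl)
  ... | inj₁ (s≤s {n = M} k≤M) = unitriangular-coordinates-unique tri M same′ k k≤M
    where
      same′ : ∀ i → i ≤ M → sumTo M (λ k → D k * h k i) ≈ sumTo M (λ k → D′ k * h k i)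
      same′ i i≤M = ∙-cancelʳ _ _ _ (trans (same i (ℕP.m≤n⇒m≤1+n i≤M))
                      (+-cong refl (*-cong (sym (unitriangular-top-unique tri N (same N ℕP.≤-refl))) refl)))

  module FrobeniusEulerBasis (λ′ : Carrier) (r : ℕ) (H : ℕ → Poly) (isFE : IsFrobeniusEuler λ′ r H) where
    private
      E : EGF
      E = egf-pow (expMinus λ′) r
      h : ℕ → ℕ → Carrier
      h k i = coeff (H k) i
      cc : Carrier
      cc = (1# + - λ′) ^ r

    frobeniusEuler-δ : ∀ n i → sumTo n (λ k → fromℕ (n C k) * (E (n ∸ k) * h k i)) ≈ cc * δ n i
    -- The Kronecker delta in `IsFrobeniusEuler` is local to that definition;
    -- `rekey` lets unification supply it as `d`.
    frobeniusEuler-δ = rekey isFE (δ-unique ≡.refl (λ _ → ≡.refl) (λ _ → ≡.refl) (λ _ _ → ≡.refl))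
      where
        rekey : ∀ {d d′ : ℕ → ℕ → Carrier} →
          (∀ n i → sumTo n (λ k → fromℕ (n C k) * (E (n ∸ k) * h k i)) ≈ cc * d n i) →
          (∀ n i → d n i ≡ d′ n i) →
          ∀ n i → sumTo n (λ k → fromℕ (n C k) * (E (n ∸ k) * h k i)) ≈ cc * d′ n i
        rekey fe d≡d′ n i = trans (fe n i) (*-cong refl (reflexive (d≡d′ n i)))

    frobeniusEuler-unitriangular : ¬ (λ′ ≈ 1#) → Unitriangular h
    frobeniusEuler-unitriangular λ′≉1 = <-rec _ row
      where
        row : ∀ k → (∀ {j} → j < k → ∀ i → j ≤ i → h j i ≈ δ j i) → ∀ i → k ≤ i → h k i ≈ δ k i
        row k below i k≤i = *-cancelˡ-≉0 (^-≉0 (1-x≉0 λ′≉1) r) (begin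
          cc * h k i                                          ≈⟨ *-cong (sym (expMinus-pow-zero λ′ r)) refl ⟩
          E 0 * h k i                                         ≈⟨ sym diagonal ⟩
          fromℕ (k C k) * (E (k ∸ k) * h k i)                 ≈⟨ sym (sumTo-single k _ ℕP.≤-refl lower) ⟩
          sumTo k (λ j → fromℕ (k C j) * (E (k ∸ j) * h j i)) ≈⟨ frobeniusEuler-δ k i ⟩
          cc * δ k i                                          ∎)
          where
            diagonal : fromℕ (k C k) * (E (k ∸ k) * h k i) ≈ E 0 * h k i
            diagonal = trans (*-cong (fromℕ-cong (nCn≡1 k)) (reflexive (≡.cong (λ e → E e * h k i) (ℕP.n∸n≡0 k))))
                             (fromℕ-1* _)
            lower : ∀ j → j ≤ k → j ≢ k → fromℕ (k C j) * (E (k ∸ j) * h j i) ≈ 0#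
            lower j j≤k j≢k = y≈0⇒x*y≈0 (y≈0⇒x*y≈0 h≈0)
              where
                j<k : j < k
                j<k = ℕP.≤∧≢⇒< j≤k j≢k
                j<i : j < i
                j<i = ℕP.<-≤-trans j<k k≤i
                h≈0 : h j i ≈ 0#
                h≈0 = trans (below j<k i (ℕP.<⇒≤ j<i)) (δ-≢ (ℕP.<⇒≢ j<i))

    scaledCoordinate : ℕ → Poly → ℕ → Carrier
    scaledCoordinate N p k = sumTo N (λ i → coeff p i * (fromℕ (i C k) * E (i ∸ k)))

    frobeniusEuler-expansion : ∀ N p i → i ≤ N → sumTo N (λ k → scaledCoordinate N p k * h k i) ≈ cc * coeff p i
    frobeniusEuler-expansion N p i i≤N = begin
      sumTo N (λ k → scaledCoordinate N p k * h k i)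
        ≈⟨ sumTo-cong N (λ k _ → trans (*-distribʳ-sumTo N (h k i) _) (sumTo-cong N (λ j _ → regroup))) ⟩
      sumTo N (λ k → sumTo N (λ j → coeff p j * (fromℕ (j C k) * (E (j ∸ k) * h k i))))
        ≈⟨ sumTo-comm N N _ ⟩
      sumTo N (λ j → sumTo N (λ k → coeff p j * (fromℕ (j C k) * (E (j ∸ k) * h k i))))
        ≈⟨ sumTo-cong N (λ j j≤N → trans (sym (*-distribˡ-sumTo N (coeff p j) _)) (*-cong refl (monomial j j≤N))) ⟩
      sumTo N (λ j → coeff p j * (cc * δ j i))
        ≈⟨ sumTo-single N _ i≤N (λ j _ j≢i → y≈0⇒x*y≈0 (y≈0⇒x*y≈0 (δ-≢ j≢i))) ⟩
      coeff p i * (cc * δ i i)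
        ≈⟨ trans (*-cong refl (trans (*-cong refl (δ-diag i)) (*-identityʳ _))) (*-comm _ _) ⟩
      cc * coeff p i ∎
      where
        regroup : ∀ {a b c d} → (a * (b * c)) * d ≈ a * (b * (c * d))
        regroup = trans (*-assoc _ _ _) (*-cong refl (*-assoc _ _ _))
        monomial : ∀ j → j ≤ N → sumTo N (λ k → fromℕ (j C k) * (E (j ∸ k) * h k i)) ≈ cc * δ j i
        monomial j j≤N = trans (sumTo-truncate _ j≤N (λ k → k>n⇒nCk*x≈0 _)) (frobeniusEuler-δ j i)

    frobeniusEuler-coordinates : ¬ (λ′ ≈ 1#) → ∀ n p (Cf : ℕ → Carrier) →
      (∀ i → coeff p i ≈ sumTo n (λ k → Cf k * h k i)) → ∀ k → k ≤ n → cc * Cf k ≈ scaledCoordinate n p k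
    frobeniusEuler-coordinates λ′≉1 n p Cf p≈ΣCfH =
      unitriangular-coordinates-unique (frobeniusEuler-unitriangular λ′≉1) n same
      where
        same : ∀ i → i ≤ n → sumTo n (λ k → (cc * Cf k) * h k i) ≈ sumTo n (λ k → scaledCoordinate n p k * h k i)
        same i i≤n = begin
          sumTo n (λ k → (cc * Cf k) * h k i)   ≈⟨ sumTo-cong n (λ k _ → *-assoc _ _ _) ⟩
          sumTo n (λ k → cc * (Cf k * h k i))   ≈⟨ sym (*-distribˡ-sumTo n cc _) ⟩
          cc * sumTo n (λ k → Cf k * h k i)     ≈⟨ *-cong refl (sym (p≈ΣCfH i)) ⟩
          cc * coeff p i                        ≈⟨ sym (frobeniusEuler-expansion n p i i≤n) ⟩
          sumTo n (λ k → scaledCoordinate n p k * h k i) ∎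

    factorial-scaledCoordinate : ∀ n p → (∀ i → n < i → coeff p i ≈ 0#) → ∀ k → k ≤ n →
      fromℕ (k !) * scaledCoordinate n p k ≈ sumTo n (λ m → coeff (derivN k p) m * E m)
    factorial-scaledCoordinate n p p≈0 k k≤n = begin
      fromℕ (k !) * sumTo n term
        ≡⟨ ≡.cong (λ N → fromℕ (k !) * sumTo N term) (≡.sym (ℕP.m∸n+n≡m k≤n)) ⟩
      fromℕ (k !) * sumTo (n ∸ k ℕ.+ k) term
        ≈⟨ *-cong refl (sumTo-offset (n ∸ k) k term below-k) ⟩
      fromℕ (k !) * sumTo (n ∸ k) (λ m → term (m ℕ.+ k))
        ≈⟨ trans (*-distribˡ-sumTo (n ∸ k) _ _) (sumTo-cong (n ∸ k) (λ m _ → shifted m)) ⟩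
      sumTo (n ∸ k) (λ m → coeff (derivN k p) m * E m)
        ≈⟨ sym (sumTo-truncate _ (ℕP.m∸n≤m n k) (λ m → x≈0⇒x*y≈0 ∘ coeff-derivN-vanishes k p n p≈0 m ∘ n<m+k)) ⟩
      sumTo n (λ m → coeff (derivN k p) m * E m) ∎
      where
        term : ℕ → Carrier
        term i = coeff p i * (fromℕ (i C k) * E (i ∸ k))
        below-k : ∀ i → i < k → term i ≈ 0#
        below-k i i<k = y≈0⇒x*y≈0 (k>n⇒nCk*x≈0 _ i<k)
        n<m+k : ∀ {m} → n ∸ k < m → n < m ℕ.+ k
        n<m+k {m} n∸k<m = ≡.subst (_< m ℕ.+ k) (ℕP.m∸n+n≡m k≤n) (ℕP.+-monoˡ-< k n∸k<m)
        shifted : ∀ m → fromℕ (k !) * term (m ℕ.+ k) ≈ coeff (derivN k p) m * E m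
        shifted m = begin
          fromℕ (k !) * (coeff p (m ℕ.+ k) * (fromℕ ((m ℕ.+ k) C k) * E (m ℕ.+ k ∸ k)))
            ≈⟨ x∙yz≈y∙xz _ _ _ ⟩
          coeff p (m ℕ.+ k) * (fromℕ (k !) * (fromℕ ((m ℕ.+ k) C k) * E (m ℕ.+ k ∸ k)))
            ≈⟨ *-cong refl (trans (x∙yz≈xy∙z _ _ _) (*-cong (sym (fromℕ-* (k !) ((m ℕ.+ k) C k))) refl)) ⟩
          coeff p (m ℕ.+ k) * (fromℕ (k ! ℕ.* ((m ℕ.+ k) C k)) * E (m ℕ.+ k ∸ k))
            ≈⟨ *-cong refl (*-cong (fromℕ-cong (k!*nCk≡nP′k (ℕP.m≤n+m k m)))
                                    (reflexive (≡.cong E (ℕP.m+n∸n≡m m k)))) ⟩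
          coeff p (m ℕ.+ k) * (fromℕ ((m ℕ.+ k) P′ k) * E m)
            ≈⟨ x∙yz≈yx∙z _ _ _ ⟩
          (fromℕ ((m ℕ.+ k) P′ k) * coeff p (m ℕ.+ k)) * E m
            ≈⟨ *-cong (sym (coeff-derivN k p m)) refl ⟩
          coeff (derivN k p) m * E m ∎

theorem5 : ∀ {c ℓ} (F : Field c ℓ) → FieldDefs.CharZero F →
    let open Field F in
    let open CommutativeRing commutativeRing in
    let open FieldDefs F in
    (λ′ : Carrier) → ¬ (λ′ ≈ 1#) → (r n : ℕ) →
    (H : ℕ → Poly) → IsFrobeniusEuler λ′ r H →
    (p : Poly) → length p ≤ suc n →
    (Cf : ℕ → Carrier) →
    (∀ i → coeff p i ≈ sumTo n (λ k → Cf k * coeff (H k) i)) →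
    ∀ k → k ≤ n →
    ((1# + - λ′) ^ r) * (fromℕ (k !) * Cf k)
    ≈ sumTo r (λ j → fromℕ (r C j) * (((- λ′) ^ (r ∸ j)) * eval (derivN k p) (fromℕ j)))
theorem5 F _ λ′ λ′≉1 r n H isFE p len≤1+n Cf p≈ΣCfH k k≤n = begin
  (1# + - λ′) ^ r * (fromℕ (k !) * Cf k)   ≈⟨ x∙yz≈y∙xz _ _ _ ⟩
  fromℕ (k !) * ((1# + - λ′) ^ r * Cf k)   ≈⟨ *-cong refl (frobeniusEuler-coordinates λ′≉1 n p Cf p≈ΣCfH k k≤n) ⟩
  fromℕ (k !) * scaledCoordinate n p k     ≈⟨ factorial-scaledCoordinate n p p≈0 k k≤n ⟩
  sumTo n (λ m → coeff (derivN k p) m * egf-pow (expMinus λ′) r m)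
    ≈⟨ expMinus-pow-eval λ′ r (derivN k p) n (λ m n<m → coeff-derivN-vanishes k p n p≈0 m (ℕP.m≤n⇒m≤n+o k n<m)) ⟩
  binomialSum r (- λ′) (λ j → eval (derivN k p) (fromℕ j)) ∎
  where
    open Field F
    open CommutativeRing commutativeRing
    open FieldDefs F
    open OverField F
    open FrobeniusEulerBasis λ′ r H isFE
    open import Relation.Binary.Reasoning.Setoid setoid
    open CommSemigroupProperties *-commutativeSemigroup using (x∙yz≈y∙xz)
    p≈0 : ∀ i → n < i → coeff p i ≈ 0#
    p≈0 i n<i = reflexive (coeff-≥length p (ℕP.≤-trans len≤1+n n<i))
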